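{- Let $\pi$ be a Fano permutation of $\mathbb{Z}_2^3$. Then for all non-zero $x\neq y$ in $\mathbb{Z}_2^3$, $\langle x,\pi(y)\rangle \oplus \langle y,\pi(x)\rangle = 1$.
   Context: $\oplus$ denotes addition in $\mathbb{Z}_2^3$ (and in $\mathbb{Z}_2$), and $\langle\cdot,\cdot\rangle$ the standard inner product over $\mathbb{Z}_2$; $x^\perp=\{y : \langle x,y\rangle=0\}$. A permutation $\pi$ of $\mathbb{Z}_2^3$ is antilinear if (a) $\pi(0)=0$, and (b) for all non-zero $x,y,z$, either $x\oplus y\oplus z\neq 0$ or $\pi(x)\oplus\pi(y)\oplus\pi(z)\neq0$. The signature of $\pi$ is $\sigma(x)=\bigoplus_{y\in x^\perp}\pi(y)$. An antilinear permutation is Fano if its signature is the identity map. -}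

module Defs where

open import Data.Bool using (Bool; true; false; _xor_; _∧_; if_then_else_; not)
open import Data.Bool.Properties using () renaming (_≟_ to _≟_)
open import Data.Vec using (Vec; []; _∷_; zipWith; replicate)
open import Data.List using (List; []; _∷_; foldr; filter; map)
open import Data.Product using (_×_)
open import Data.Sum using (_⊎_)
open import Relation.Binary.PropositionalEquality using (_≡_; _≢_)
open import Function.Bundles using (_↔_; Inverse)

-- Z₂ is Bool (false = 0, true = 1, addition = xor, multiplication = ∧)
-- Z₂³ as vectors of length 3 over Bool
V : Set
V = Vec Bool 3

0V : V
0V = replicate 3 false

_⊕_ : V → V → V
_⊕_ = zipWith _xor_

infixl 6 _⊕_

⟨_,_⟩ : V → V → Bool
⟨ a ∷ b ∷ c ∷ [] , a' ∷ b' ∷ c' ∷ [] ⟩ = (a ∧ a') xor ((b ∧ b') xor (c ∧ c'))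

allV : List V
allV =
  (false ∷ false ∷ false ∷ []) ∷ (false ∷ false ∷ true ∷ []) ∷
  (false ∷ true ∷ false ∷ []) ∷ (false ∷ true ∷ true ∷ []) ∷
  (true ∷ false ∷ false ∷ []) ∷ (true ∷ false ∷ true ∷ []) ∷
  (true ∷ true ∷ false ∷ []) ∷ (true ∷ true ∷ true ∷ []) ∷ []

⨁ : List V → V
⨁ = foldr _⊕_ 0V

Perm : Set
Perm = V ↔ V

Antilinear : Perm → Set
Antilinear π =
  (f 0V ≡ 0V) ×
  (∀ x y z → x ≢ 0V → y ≢ 0V → z ≢ 0V →
     (x ⊕ y ⊕ z ≢ 0V) ⊎ (f x ⊕ f y ⊕ f z ≢ 0V))
  where f = Inverse.to π

perp : V → List V
perp x = filter (λ y → not ⟨ x , y ⟩ ≟ true) allV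

signature : Perm → V → V
signature π x = ⨁ (map (Inverse.to π) (perp x))

Fano : Perm → Set
Fano π = Antilinear π × (∀ x → signature π x ≡ x)

-- For x ≠ 0, x^⊥ consists of 0 and one line of the Fano plane, so σ(x) = x says
-- that π sums to x over that line. Four of these equations determine π from
-- a = π(v₁), b = π(v₂), c = π(v₄); the claim is then checked by evaluation for
-- every injective map of the resulting 8³-element family.
module Submission where

open import Defs
open import Data.Bool using (true; false; _xor_)
open import Data.Bool.Properties using (xor-assoc; xor-identityˡ; xor-identityʳ; xor-same)
  renaming (_≟_ to _≟ᵇ_)
open import Data.Vec using ([]; _∷_)
open import Data.Vec.Properties
  using (≡-dec; zipWith-assoc; zipWith-identityˡ; zipWith-identityʳ; zipWith-inverseˡ; map-id)
open import Data.List using ([]; _∷_; map)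
open import Data.List.Membership.Propositional using (_∈_)
open import Data.List.Relation.Unary.Any using (here; there)
open import Data.List.Relation.Unary.All as All using (all?)
open import Data.Product using (_,_)
open import Function.Bundles using (Inverse; Injection)
open import Function.Definitions using (Injective)
open import Function.Properties.Inverse using (Inverse⇒Injection)
open import Relation.Binary.Definitions using (DecidableEquality)
open import Relation.Binary.PropositionalEquality
  using (_≡_; _≢_; _≗_; refl; sym; trans; cong; cong₂; module ≡-Reasoning)
open import Relation.Nullary using (Dec; ¬?)
open import Relation.Nullary.Decidable using (map′; _→-dec_; toWitness)
open import Relation.Unary using (Pred; Decidable)

infix 4 _≟_

_≟_ : DecidableEquality V
_≟_ = ≡-dec _≟ᵇ_

⊕-assoc : ∀ x y z → (x ⊕ y) ⊕ z ≡ x ⊕ (y ⊕ z)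
⊕-assoc = zipWith-assoc xor-assoc

⊕-identityˡ : ∀ x → 0V ⊕ x ≡ x
⊕-identityˡ = zipWith-identityˡ xor-identityˡ

⊕-identityʳ : ∀ x → x ⊕ 0V ≡ x
⊕-identityʳ = zipWith-identityʳ xor-identityʳ

⊕-self : ∀ x → x ⊕ x ≡ 0V
⊕-self x = trans (cong (_⊕ x) (sym (map-id x))) (zipWith-inverseˡ xor-same x)

⊕-move : ∀ {x y z} → x ⊕ y ≡ z → y ≡ x ⊕ z
⊕-move {x} {y} {z} e = begin
  y             ≡⟨ sym (⊕-identityˡ y) ⟩
  0V ⊕ y        ≡⟨ cong (_⊕ y) (sym (⊕-self x)) ⟩
  (x ⊕ x) ⊕ y   ≡⟨ ⊕-assoc x x y ⟩
  x ⊕ (x ⊕ y)   ≡⟨ cong (x ⊕_) e ⟩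
  x ⊕ z         ∎
  where open ≡-Reasoning

⨁-solve : ∀ {o a b d w} → o ≡ 0V → ⨁ (o ∷ a ∷ b ∷ d ∷ []) ≡ w → d ≡ b ⊕ (a ⊕ w)
⨁-solve {d = d} refl e =
  trans (sym (⊕-identityʳ d)) (⊕-move (⊕-move (trans (sym (⊕-identityˡ _)) e)))

pattern v₀ = false ∷ false ∷ false ∷ []
pattern v₁ = false ∷ false ∷ true ∷ []
pattern v₂ = false ∷ true ∷ false ∷ []
pattern v₃ = false ∷ true ∷ true ∷ []
pattern v₄ = true ∷ false ∷ false ∷ []
pattern v₅ = true ∷ false ∷ true ∷ []
pattern v₆ = true ∷ true ∷ false ∷ []
pattern v₇ = true ∷ true ∷ true ∷ []

∈-allV : ∀ v → v ∈ allV
∈-allV v₀ = here refl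
∈-allV v₁ = there (here refl)
∈-allV v₂ = there (there (here refl))
∈-allV v₃ = there (there (there (here refl)))
∈-allV v₄ = there (there (there (there (here refl))))
∈-allV v₅ = there (there (there (there (there (here refl)))))
∈-allV v₆ = there (there (there (there (there (there (here refl))))))
∈-allV v₇ = there (there (there (there (there (there (there (here refl)))))))

∀V? : ∀ {ℓ} {P : Pred V ℓ} → Decidable P → Dec (∀ v → P v)
∀V? P? = map′ (λ h v → All.lookup h (∈-allV v)) (λ h → All.tabulate (λ {v} _ → h v)) (all? P? allV)

extend : V → V → V → V → V
extend a b c v₀ = 0V
extend a b c v₁ = a
extend a b c v₂ = b
extend a b c v₃ = b ⊕ (a ⊕ v₄)
extend a b c v₄ = c
extend a b c v₅ = c ⊕ (a ⊕ v₂)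
extend a b c v₆ = c ⊕ (b ⊕ v₁)
extend a b c v₇ = (c ⊕ (b ⊕ v₁)) ⊕ (a ⊕ v₆)

CrossPairingsDiffer : (V → V) → Set
CrossPairingsDiffer f = ∀ x y → x ≢ 0V → y ≢ 0V → x ≢ y → (⟨ x , f y ⟩ xor ⟨ y , f x ⟩) ≡ true

InjectiveV : (V → V) → Set
InjectiveV f = ∀ x y → f x ≡ f y → x ≡ y

injectiveV? : ∀ f → Dec (InjectiveV f)
injectiveV? f = ∀V? λ x → ∀V? λ y → (f x ≟ f y) →-dec (x ≟ y)

crossPairingsDiffer? : ∀ f → Dec (CrossPairingsDiffer f)
crossPairingsDiffer? f = ∀V? λ x → ∀V? λ y →
  ¬? (x ≟ 0V) →-dec ¬? (y ≟ 0V) →-dec ¬? (x ≟ y) →-dec (⟨ x , f y ⟩ xor ⟨ y , f x ⟩) ≟ᵇ true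

injective-extend⇒crossPairingsDiffer : ∀ a b c → InjectiveV (extend a b c) → CrossPairingsDiffer (extend a b c)
injective-extend⇒crossPairingsDiffer = toWitness {a? = ∀V? λ a → ∀V? λ b → ∀V? λ c →
  injectiveV? (extend a b c) →-dec crossPairingsDiffer? (extend a b c)} _

extend-unique : (f : V → V) → f 0V ≡ 0V → (∀ x → ⨁ (map f (perp x)) ≡ x) →
                f ≗ extend (f v₁) (f v₂) (f v₄)
extend-unique f f0≡0 σ≡id = λ where
    v₀ → f0≡0
    v₁ → refl
    v₂ → refl
    v₃ → last-on-line v₁ v₂ v₃ (σ≡id v₄)
    v₄ → refl
    v₅ → last-on-line v₁ v₄ v₅ (σ≡id v₂)
    v₆ → f₆
    v₇ → trans (last-on-line v₁ v₆ v₇ (σ≡id v₆)) (cong (_⊕ (f v₁ ⊕ v₆)) f₆)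
  where
  last-on-line : ∀ p q r {w} → ⨁ (map f (v₀ ∷ p ∷ q ∷ r ∷ [])) ≡ w → f r ≡ f q ⊕ (f p ⊕ w)
  last-on-line p q r = ⨁-solve f0≡0

  f₆ : f v₆ ≡ f v₄ ⊕ (f v₂ ⊕ v₁)
  f₆ = last-on-line v₂ v₄ v₆ (σ≡id v₁)

signature-id⇒crossPairingsDiffer : (f : V → V) → f 0V ≡ 0V → (∀ x → ⨁ (map f (perp x)) ≡ x) →
                                   Injective _≡_ _≡_ f → CrossPairingsDiffer f
signature-id⇒crossPairingsDiffer f f0≡0 σ≡id f-inj x y x≢0 y≢0 x≢y = begin
  ⟨ x , f y ⟩ xor ⟨ y , f x ⟩  ≡⟨ cong₂ (λ u w → ⟨ x , u ⟩ xor ⟨ y , w ⟩) (f≗g y) (f≗g x) ⟩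
  ⟨ x , g y ⟩ xor ⟨ y , g x ⟩  ≡⟨ injective-extend⇒crossPairingsDiffer _ _ _ g-inj x y x≢0 y≢0 x≢y ⟩
  true                         ∎
  where
  open ≡-Reasoning
  g : V → V
  g = extend (f v₁) (f v₂) (f v₄)
  f≗g : f ≗ g
  f≗g = extend-unique f f0≡0 σ≡id
  g-inj : InjectiveV g
  g-inj u v e = f-inj (trans (f≗g u) (trans e (sym (f≗g v))))

lemma6 : (π : Perm) → Fano π → ∀ x y → x ≢ 0V → y ≢ 0V → x ≢ y →
    (⟨ x , Inverse.to π y ⟩ xor ⟨ y , Inverse.to π x ⟩) ≡ true
lemma6 π ((π0≡0 , _) , σ≡id) =
  signature-id⇒crossPairingsDiffer (Inverse.to π) π0≡0 σ≡id (Injection.injective (Inverse⇒Injection π))
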